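{- In $\mathbb{Z}_{71}$ let $H=\{1,5,25,54,57\}$, and write $HS=\{hs\bmod 71: h\in H, s\in S\}$. Let $X=H\{1,2,3,6,11,14,27\}$ and $Y=H\{1,2,3,9,14,18,42\}$. Then $(X,Y)$ is a Legendre difference family in $\mathbb{Z}_{71}$ with parameters $(71;35,35;34)$ of type $2$.
   Context: A pair $(X,Y)$ of subsets of $\mathbb{Z}_v$ with $|X|=k_1$, $|Y|=k_2$ is a difference family with parameters $(v;k_1,k_2;\lambda)$ if every nonzero $d\in\mathbb{Z}_v$ arises as $x-x'$ ($x,x'\in X$) or $y-y'$ ($y,y'\in Y$) in exactly $\lambda$ ways in total; it is a Legendre difference family if $v=2(k_1+k_2-\lambda)-1$. A subset $X\subseteq\mathbb{Z}_v$ is a difference set if every nonzero element of $\mathbb{Z}_v$ arises as $x-x'$ with $x,x'\in X$ the same number of times. A Legendre difference family $(X,Y)$ is of type $1$ if $X$ is a difference set (then $Y$ is one too), and of type $2$ otherwise. -}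

module Defs where

open import Data.Nat using (ℕ; zero; suc; _+_; _*_; _∸_; _≡ᵇ_; NonZero)
open import Data.Nat.DivMod using (_%_)
open import Data.Bool using (Bool; true; false; _∧_; _∨_; if_then_else_)
open import Data.Fin using (Fin; toℕ)
open import Data.Fin.Subset using (Subset; ∣_∣)
open import Data.List using (List; []; _∷_; allFin; map; concatMap)
open import Data.Nat.ListAction using (sum)
open import Data.Bool.ListAction using (any)
open import Data.Vec using (lookup; tabulate)
open import Data.Product using (∃; _×_)
open import Relation.Binary.PropositionalEquality using (_≡_)
open import Relation.Nullary using (¬_)

mem : ∀ {v} → Subset v → Fin v → Bool
mem X x with lookup X x
... | Data.Fin.Subset.inside  = true
... | Data.Fin.Subset.outside = false

-- Number of ordered pairs (x , x') ∈ X × X with x - x' ≡ d in ℤ_v,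
-- i.e. toℕ x ≡ (toℕ x' + toℕ d) mod v.
diffCount : ∀ v → .{{_ : NonZero v}} → Subset v → Fin v → ℕ
diffCount v X d =
  sum (concatMap (λ x → map (λ x' →
        if mem X x ∧ mem X x' ∧ (toℕ x ≡ᵇ ((toℕ x' + toℕ d) % v)) then 1 else 0)
      (allFin v)) (allFin v))

IsDifferenceFamily : ∀ v → .{{_ : NonZero v}} → ℕ → ℕ → ℕ → Subset v → Subset v → Set
IsDifferenceFamily v k₁ k₂ lam X Y =
  (∣ X ∣ ≡ k₁) × (∣ Y ∣ ≡ k₂) ×
  (∀ (d : Fin v) → ¬ (toℕ d ≡ 0) → diffCount v X d + diffCount v Y d ≡ lam)

IsLegendreDF : ∀ v → .{{_ : NonZero v}} → ℕ → ℕ → ℕ → Subset v → Subset v → Set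
IsLegendreDF v k₁ k₂ lam X Y =
  IsDifferenceFamily v k₁ k₂ lam X Y × (v + 1 ≡ 2 * ((k₁ + k₂) ∸ lam))

IsDifferenceSet : ∀ v → .{{_ : NonZero v}} → Subset v → Set
IsDifferenceSet v X = ∃ λ μ → ∀ (d : Fin v) → ¬ (toℕ d ≡ 0) → diffCount v X d ≡ μ

IsLegendreDFType2 : ∀ v → .{{_ : NonZero v}} → ℕ → ℕ → ℕ → Subset v → Subset v → Set
IsLegendreDFType2 v k₁ k₂ lam X Y =
  IsLegendreDF v k₁ k₂ lam X Y × ¬ IsDifferenceSet v X

prodSet : ∀ v → .{{_ : NonZero v}} → List ℕ → List ℕ → Subset v
prodSet v H S = tabulate λ z →
  if any (λ h → any (λ s → ((h * s) % v) ≡ᵇ toℕ z) S) H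
  then Data.Fin.Subset.inside else Data.Fin.Subset.outside

H71 : List ℕ
H71 = 1 ∷ 5 ∷ 25 ∷ 54 ∷ 57 ∷ []

X71 : Subset 71
X71 = prodSet 71 H71 (1 ∷ 2 ∷ 3 ∷ 6 ∷ 11 ∷ 14 ∷ 27 ∷ [])

Y71 : Subset 71
Y71 = prodSet 71 H71 (1 ∷ 2 ∷ 3 ∷ 9 ∷ 14 ∷ 18 ∷ 42 ∷ [])

-- A finite computation in ℤ₇₁: the table of d ↦ diffCount X d + diffCount Y d
-- evaluates to 34 at every d ≠ 0, while X alone represents 1 fifteen times
-- but 2 eighteen times, so X is not a difference set.
module Submission where

open import Defs
open import Data.Nat using (ℕ; suc; NonZero; _+_)
open import Data.Fin using (Fin; zero; suc; toℕ)
open import Data.Fin.Subset using (Subset)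
open import Data.Vec using (_∷_; tabulate; replicate; lookup)
open import Data.Vec.Properties using (lookup∘tabulate; lookup-replicate)
open import Data.Product using (_,_)
open import Data.Empty using (⊥-elim)
open import Relation.Binary.PropositionalEquality using (_≡_; _≢_; refl; cong; sym; trans; module ≡-Reasoning)
open import Relation.Nullary using (¬_)

constant-off-zero : ∀ {n} {c μ : ℕ} (f : Fin (suc n) → ℕ) →
                    tabulate f ≡ c ∷ replicate n μ →
                    ∀ d → toℕ d ≢ 0 → f d ≡ μ
constant-off-zero f table zero    d≢0 = ⊥-elim (d≢0 refl)
constant-off-zero {n} {μ = μ} f table (suc d) _ = begin
  f (suc d)                     ≡⟨ lookup∘tabulate f (suc d) ⟨
  lookup (tabulate f) (suc d)   ≡⟨ cong (λ t → lookup t (suc d)) table ⟩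
  lookup (replicate n μ) d      ≡⟨ lookup-replicate d μ ⟩
  μ                             ∎
  where open ≡-Reasoning

¬differenceSet-by-two-counts : ∀ {v} .{{_ : NonZero v}} (X : Subset v) (d e : Fin v) →
                               toℕ d ≢ 0 → toℕ e ≢ 0 →
                               diffCount v X d ≢ diffCount v X e →
                               ¬ IsDifferenceSet v X
¬differenceSet-by-two-counts X d e d≢0 e≢0 counts≢ (μ , constant) =
  counts≢ (trans (constant d d≢0) (sym (constant e e≢0)))

pairCount-table : tabulate (λ d → diffCount 71 X71 d + diffCount 71 Y71 d)
                  ≡ 70 ∷ replicate 70 34
pairCount-table = refl

X71-count-1≢count-2 : diffCount 71 X71 (suc zero) ≢ diffCount 71 X71 (suc (suc zero))
X71-count-1≢count-2 ()

mainTheorem6 : IsLegendreDFType2 71 35 35 34 X71 Y71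
mainTheorem6 = ((refl , refl , constant-off-zero _ pairCount-table) , refl)
             , ¬differenceSet-by-two-counts X71 (suc zero) (suc (suc zero))
                 (λ ()) (λ ()) X71-count-1≢count-2
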